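{- Let $G$ be a simple connected graph of order $n\geq 3$. Then $\tau(G)=\gamma(R(G))$.
   Context: $R(G)$ is the graph obtained from $G$ by adding, for each edge $e=xy\in E(G)$, a new vertex $v_e$ adjacent exactly to $x$ and $y$. $\tau(G)$ is the vertex cover number of $G$ (minimum size of a set of vertices meeting every edge), and $\gamma(H)$ is the domination number of $H$ (minimum size of a set $S$ such that every vertex is in $S$ or adjacent to a vertex of $S$). -}

module Defs where

open import Data.Nat using (ℕ; _≤_; _<_)
open import Data.Fin using (Fin; toℕ)
open import Data.Bool using (Bool; true; false)
open import Data.Product using (Σ; ∃; _×_; _,_)
open import Data.Sum using (_⊎_; inj₁; inj₂)
open import Data.Empty using (⊥)
open import Data.List using (List; length)
open import Data.List.Membership.Propositional using (_∈_)
open import Data.List.Relation.Unary.Unique.Propositional using (Unique)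
open import Relation.Binary.PropositionalEquality using (_≡_)

record SimpleGraph (n : ℕ) : Set where
  field
    adj   : Fin n → Fin n → Bool
    sym   : ∀ x y → adj x y ≡ adj y x
    irref : ∀ x → adj x x ≡ false

open SimpleGraph public

Adj : ∀ {n} → SimpleGraph n → Fin n → Fin n → Set
Adj G x y = adj G x y ≡ true

data Walk {n} (G : SimpleGraph n) : Fin n → Fin n → Set where
  here  : ∀ {x} → Walk G x x
  step  : ∀ {x y z} → Adj G x y → Walk G y z → Walk G x z

Connected : ∀ {n} → SimpleGraph n → Set
Connected {n} G = ∀ (x y : Fin n) → Walk G x y

-- edges of G, each listed once as (x , y) with x < y
Edge : ∀ {n} → SimpleGraph n → Set
Edge {n} G = Σ (Fin n × Fin n) (λ { (x , y) → (toℕ x < toℕ y) × Adj G x y })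

-- vertices of R(G): the old vertices plus one new vertex v_e per edge e
RV : ∀ {n} → SimpleGraph n → Set
RV {n} G = Fin n ⊎ Edge G

RAdj : ∀ {n} (G : SimpleGraph n) → RV G → RV G → Set
RAdj G (inj₁ x) (inj₁ y) = Adj G x y
RAdj G (inj₁ z) (inj₂ ((x , y) , _)) = (z ≡ x) ⊎ (z ≡ y)
RAdj G (inj₂ ((x , y) , _)) (inj₁ z) = (z ≡ x) ⊎ (z ≡ y)
RAdj G (inj₂ _) (inj₂ _) = ⊥

-- finite vertex subsets are duplicate-free lists; size = length

IsVertexCover : ∀ {n} (G : SimpleGraph n) → List (Fin n) → Set
IsVertexCover {n} G S = ∀ (x y : Fin n) → Adj G x y → (x ∈ S) ⊎ (y ∈ S)

VertexCoverNumber : ∀ {n} → SimpleGraph n → ℕ → Set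
VertexCoverNumber {n} G k =
  (Σ (List (Fin n)) λ S → Unique S × IsVertexCover G S × length S ≡ k)
  × (∀ (S : List (Fin n)) → Unique S → IsVertexCover G S → k ≤ length S)

IsDominating : (V : Set) → (V → V → Set) → List V → Set
IsDominating V E S = ∀ (v : V) → (v ∈ S) ⊎ (∃ λ u → (u ∈ S) × E u v)

DominationNumber : (V : Set) → (V → V → Set) → ℕ → Set
DominationNumber V E k =
  (Σ (List V) λ S → Unique S × IsDominating V E S × length S ≡ k)
  × (∀ (S : List V) → Unique S → IsDominating V E S → k ≤ length S)

RDominationNumber : ∀ {n} → SimpleGraph n → ℕ → Set
RDominationNumber G k = DominationNumber (RV G) (RAdj G) k

-- A vertex cover S of G dominates R(G): each new vertex v_xy sees the endpoint
-- of xy lying in S, and an old vertex outside S has a neighbour (G is connected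
-- with at least two vertices), which lies in S.  Conversely, from a dominating
-- set of R(G) replace each new vertex v_xy by x; the result is no larger, and
-- it covers every edge xy because v_xy is dominated by itself, x or y.
module Submission where

open import Defs hiding (sym)
open import Data.Nat using (ℕ; _≤_; s≤s)
open import Data.Nat.Properties using (≤-trans; ≤-reflexive; n≤1+n; <-cmp)
open import Data.Product using (Σ; ∃; _×_; _,_; proj₁; proj₂)
open import Data.Sum using (_⊎_; inj₁; inj₂; swap)
open import Data.Sum.Properties using (inj₁-injective)
open import Data.Bool using (true; false)
open import Data.Bool.Properties using () renaming (_≟_ to _≟ᵇ_)
open import Data.Fin using (Fin; toℕ) renaming (zero to fzero; suc to fsuc)
open import Data.Fin.Properties using (all?; injective⇒≤; toℕ-injective) renaming (_≟_ to _≟ᶠ_)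
open import Data.List using (List; []; _∷_; [_]; length; map; filter; _++_; lookup; allFin; deduplicate)
open import Data.List.Properties using (length-map; length-deduplicate)
open import Data.List.Membership.Propositional using (_∈_)
open import Data.List.Membership.Propositional.Properties
  using (∈-map⁺; ∈-++⁺ˡ; ∈-++⁺ʳ; ∈-filter⁺; ∈-filter⁻; ∈-allFin; ∈-lookup; ∈-deduplicate⁺)
open import Data.List.Relation.Binary.Subset.Propositional using (_⊆_)
open import Data.List.Relation.Unary.Any using (here; index)
open import Data.List.Relation.Unary.Any.Properties using (lookup-index)
import Data.List.Relation.Unary.All as All
open import Data.List.Relation.Unary.All.Properties using (all-filter)
open import Data.List.Relation.Unary.AllPairs using (_∷_)
open import Data.List.Relation.Unary.Unique.Propositional using (Unique)
import Data.List.Relation.Unary.Unique.Propositional.Properties as Unique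
open import Data.List.Relation.Unary.Unique.DecPropositional using (unique?)
open import Data.List.Relation.Unary.Unique.DecPropositional.Properties using (deduplicate-!)
open import Data.List.Extrema.Nat using (argmin; argmin-all; f[argmin]≤f[xs])
open import Function.Definitions using (Injective)
open import Relation.Nullary using (¬_; yes; no; does; contradiction)
open import Relation.Nullary.Decidable using (_×-dec_; _⊎-dec_; _→-dec_)
open import Relation.Unary using (Decidable)
open import Relation.Binary.Definitions using (DecidableEquality; tri<; tri≈; tri>)
open import Relation.Binary.PropositionalEquality using (_≡_; refl; sym; trans; cong; module ≡-Reasoning)

module _ {A : Set} where

  sublists : List A → List (List A)
  sublists []       = [ [] ]
  sublists (x ∷ xs) = map (x ∷_) (sublists xs) ++ sublists xs

  filter∈sublists : ∀ {P : A → Set} (P? : Decidable P) xs → filter P? xs ∈ sublists xs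
  filter∈sublists P? []       = here refl
  filter∈sublists P? (x ∷ xs) with does (P? x)
  ... | true  = ∈-++⁺ˡ (∈-map⁺ (x ∷_) (filter∈sublists P? xs))
  ... | false = ∈-++⁺ʳ (map (x ∷_) (sublists xs)) (filter∈sublists P? xs)

  Unique⇒lookup-injective : ∀ {xs : List A} → Unique xs → Injective _≡_ _≡_ (lookup xs)
  Unique⇒lookup-injective (_ ∷ _)    {fzero}  {fzero}  _  = refl
  Unique⇒lookup-injective (x∉xs ∷ _) {fzero}  {fsuc j} eq = contradiction eq (All.lookup x∉xs (∈-lookup j))
  Unique⇒lookup-injective (x∉xs ∷ _) {fsuc i} {fzero}  eq = contradiction (sym eq) (All.lookup x∉xs (∈-lookup i))
  Unique⇒lookup-injective (_ ∷ u)    {fsuc i} {fsuc j} eq = cong fsuc (Unique⇒lookup-injective u eq)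

  Unique-⊆⇒length≤ : ∀ {xs ys : List A} → Unique xs → xs ⊆ ys → length xs ≤ length ys
  Unique-⊆⇒length≤ {xs} {ys} u xs⊆ys = injective⇒≤ position-injective
    where
    position : Fin (length xs) → Fin (length ys)
    position i = index (xs⊆ys (∈-lookup i))

    position-injective : Injective _≡_ _≡_ position
    position-injective {i} {j} eq = Unique⇒lookup-injective u (begin
      lookup xs i                    ≡⟨ lookup-index (xs⊆ys (∈-lookup i)) ⟩
      lookup ys (position i)         ≡⟨ cong (lookup ys) eq ⟩
      lookup ys (position j)         ≡⟨ sym (lookup-index (xs⊆ys (∈-lookup j))) ⟩
      lookup xs j                    ∎)
      where open ≡-Reasoning

-- VertexCoverNumber and DominationNumber both unfold to this.
MinimumSize : (A : Set) → (List A → Set) → ℕ → Set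
MinimumSize A P k =
  (Σ (List A) λ S → Unique S × P S × length S ≡ k)
  × (∀ (S : List A) → Unique S → P S → k ≤ length S)

UpwardClosed : {A : Set} → (List A → Set) → Set
UpwardClosed P = ∀ {S T} → S ⊆ T → P S → P T

module FiniteMinimum {A : Set} (_≟_ : DecidableEquality A)
  {enum : List A} (enum-unique : Unique enum) (∈-enum : ∀ x → x ∈ enum) where

  open import Data.List.Membership.DecPropositional _≟_ using (_∈?_)

  canonical : List A → List A
  canonical S = filter (_∈? S) enum

  canonical-unique : ∀ S → Unique (canonical S)
  canonical-unique S = Unique.filter⁺ (_∈? S) enum-unique

  ⊆-canonical : ∀ S → S ⊆ canonical S
  ⊆-canonical S x∈S = ∈-filter⁺ (_∈? S) (∈-enum _) x∈S

  length-canonical : ∀ S → length (canonical S) ≤ length S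
  length-canonical S =
    Unique-⊆⇒length≤ (canonical-unique S) (λ x∈ → proj₂ (∈-filter⁻ (_∈? S) {xs = enum} x∈))

  -- Minimise length over the duplicate-free sublists of enum satisfying P;
  -- every S is beaten by its canonical sublist.
  minimumSize-exists : ∀ {P : List A → Set} → Decidable P → UpwardClosed P →
                       ∀ {S₀} → P S₀ → ∃ λ k → MinimumSize A P k
  minimumSize-exists {P} P? upward {S₀} P[S₀] =
    length M , (M , proj₁ Q[M] , proj₂ Q[M] , refl) , minimal
    where
    Q : List A → Set
    Q S = Unique S × P S

    Q? : Decidable Q
    Q? S = unique? _≟_ S ×-dec P? S

    Q-canonical : ∀ {S} → P S → Q (canonical S)
    Q-canonical {S} P[S] = canonical-unique S , upward (⊆-canonical S) P[S]

    candidates : List (List A)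
    candidates = filter Q? (sublists enum)

    M : List A
    M = argmin length (canonical S₀) candidates

    Q[M] : Q M
    Q[M] = argmin-all length (Q-canonical P[S₀]) (all-filter Q? (sublists enum))

    minimal : ∀ S → Unique S → P S → length M ≤ length S
    minimal S _ P[S] = ≤-trans
      (All.lookup (f[argmin]≤f[xs] {f = length} (canonical S₀) candidates)
        (∈-filter⁺ Q? (filter∈sublists (_∈? S) enum) (Q-canonical P[S])))
      (length-canonical S)

-- Upward closure of P lets the pulled-back list, which may repeat elements, be
-- deduplicated.
MinimumSize-transfer :
  ∀ {A B : Set} {P : List A → Set} {Q : List B → Set} {k} →
  DecidableEquality A → UpwardClosed P →
  (f : A → B) → Injective _≡_ _≡_ f → (∀ {S} → P S → Q (map f S)) →
  (g : B → A) → (∀ {D} → Q D → P (map g D)) →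
  MinimumSize A P k → MinimumSize B Q k
MinimumSize-transfer _≟_ upward f f-injective P⇒Q g Q⇒P ((M , uM , P[M] , |M|≡k) , minimal) =
  (map f M , Unique.map⁺ f-injective uM , P⇒Q P[M] , trans (length-map f M) |M|≡k) ,
  λ D _ Q[D] → ≤-trans
    (minimal (deduplicate _≟_ (map g D)) (deduplicate-! _≟_ (map g D))
      (upward (∈-deduplicate⁺ _≟_) (Q⇒P Q[D])))
    (≤-trans (length-deduplicate _≟_ (map g D)) (≤-reflexive (length-map g D)))

module _ {n : ℕ} (G : SimpleGraph n) where

  open import Data.List.Membership.DecPropositional (_≟ᶠ_ {n}) using (_∈?_)

  Adj-sym : ∀ {x y} → Adj G x y → Adj G y x
  Adj-sym {x} {y} xy = trans (SimpleGraph.sym G y x) xy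

  Adj-irrefl : ∀ {x} → ¬ Adj G x x
  Adj-irrefl {x} xx with trans (sym xx) (irref G x)
  ... | ()

  connected⇒neighbour : 2 ≤ n → Connected G → ∀ x → ∃ λ y → Adj G x y
  connected⇒neighbour (s≤s (s≤s _)) conn x = first-step (conn x (another x)) (another-≢ x)
    where
    another : Fin n → Fin n
    another fzero    = fsuc fzero
    another (fsuc _) = fzero

    another-≢ : ∀ x → ¬ x ≡ another x
    another-≢ fzero    ()
    another-≢ (fsuc _) ()

    first-step : ∀ {x y} → Walk G x y → ¬ x ≡ y → ∃ λ z → Adj G x z
    first-step here         x≢x = contradiction refl x≢x
    first-step (step xz _) _   = _ , xz

  edge-between : ∀ {x y} → Adj G x y → Σ (Edge G) λ e → proj₁ e ≡ (x , y) ⊎ proj₁ e ≡ (y , x)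
  edge-between {x} {y} xy with <-cmp (toℕ x) (toℕ y)
  ... | tri< x<y _ _ = ((x , y) , x<y , xy) , inj₁ refl
  ... | tri> _ _ y<x = ((y , x) , y<x , Adj-sym xy) , inj₂ refl
  ... | tri≈ _ x≡y _ with toℕ-injective x≡y
  ...   | refl = contradiction xy Adj-irrefl

  isVertexCover? : Decidable (IsVertexCover G)
  isVertexCover? S = all? λ x → all? λ y →
    (adj G x y ≟ᵇ true) →-dec (x ∈? S ⊎-dec y ∈? S)

  vertexCover-upwardClosed : UpwardClosed (IsVertexCover G)
  vertexCover-upwardClosed S⊆T cover x y xy with cover x y xy
  ... | inj₁ x∈S = inj₁ (S⊆T x∈S)
  ... | inj₂ y∈S = inj₂ (S⊆T y∈S)

  vertexCover-∉ : ∀ {S x y} → IsVertexCover G S → Adj G x y → ¬ x ∈ S → y ∈ S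
  vertexCover-∉ {x = x} {y} cover xy x∉S with cover x y xy
  ... | inj₁ x∈S = contradiction x∈S x∉S
  ... | inj₂ y∈S = y∈S

  allFin-vertexCover : IsVertexCover G (allFin n)
  allFin-vertexCover x _ _ = inj₁ (∈-allFin x)

  vertexCover⇒dominating : 2 ≤ n → Connected G → ∀ {S} → IsVertexCover G S →
                           IsDominating (RV G) (RAdj G) (map inj₁ S)
  vertexCover⇒dominating 2≤n conn {S} cover (inj₁ v) with v ∈? S
  ... | yes v∈S = inj₁ (∈-map⁺ inj₁ v∈S)
  ... | no  v∉S = let u , vu = connected⇒neighbour 2≤n conn v in
    inj₂ (inj₁ u , ∈-map⁺ inj₁ (vertexCover-∉ cover vu v∉S) , Adj-sym vu)
  vertexCover⇒dominating 2≤n conn cover (inj₂ ((x , y) , _ , xy)) with cover x y xy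
  ... | inj₁ x∈S = inj₂ (inj₁ x , ∈-map⁺ inj₁ x∈S , inj₁ refl)
  ... | inj₂ y∈S = inj₂ (inj₁ y , ∈-map⁺ inj₁ y∈S , inj₂ refl)

  anchor : RV G → Fin n
  anchor (inj₁ x)             = x
  anchor (inj₂ ((x , _) , _)) = x

  dominated-edge : ∀ {D} → IsDominating (RV G) (RAdj G) D → ∀ x y (e : Edge G) → proj₁ e ≡ (x , y) →
                   x ∈ map anchor D ⊎ y ∈ map anchor D
  dominated-edge dom x y e refl with dom (inj₂ e)
  ... | inj₁ e∈D                       = inj₁ (∈-map⁺ anchor e∈D)
  ... | inj₂ (inj₁ z , z∈D , inj₁ refl) = inj₁ (∈-map⁺ anchor z∈D)
  ... | inj₂ (inj₁ z , z∈D , inj₂ refl) = inj₂ (∈-map⁺ anchor z∈D)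

  dominating⇒vertexCover : ∀ {D} → IsDominating (RV G) (RAdj G) D → IsVertexCover G (map anchor D)
  dominating⇒vertexCover dom x y xy with edge-between xy
  ... | e , inj₁ e≡xy = dominated-edge dom x y e e≡xy
  ... | e , inj₂ e≡yx = swap (dominated-edge dom y x e e≡yx)

proposition2p12 : (n : ℕ) → 3 ≤ n → (G : SimpleGraph n) → Connected G →
    Σ ℕ (λ k → VertexCoverNumber G k × RDominationNumber G k)
proposition2p12 n 3≤n G conn = k , τ[G]≡k , γ[R[G]]≡k
  where
  open FiniteMinimum _≟ᶠ_ (Unique.allFin⁺ n) ∈-allFin

  minimum : ∃ λ k → MinimumSize (Fin n) (IsVertexCover G) k
  minimum = minimumSize-exists (isVertexCover? G) (vertexCover-upwardClosed G) (allFin-vertexCover G)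

  k : ℕ
  k = proj₁ minimum

  τ[G]≡k : VertexCoverNumber G k
  τ[G]≡k = proj₂ minimum

  γ[R[G]]≡k : RDominationNumber G k
  γ[R[G]]≡k = MinimumSize-transfer _≟ᶠ_ (vertexCover-upwardClosed G)
    inj₁ inj₁-injective (vertexCover⇒dominating G (≤-trans (n≤1+n 2) 3≤n) conn)
    (anchor G) (dominating⇒vertexCover G)
    τ[G]≡k
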